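{- Let $\langle M,+,\cdot\rangle$ be a topological model of ${\rm PA}^-$ with topology $\tau$, and let $b\in M$. Let $\tau^*$ be the topology on $M$ whose open sets are the sets $U\cup A$ with $U\in\tau$ and $A\subseteq\{a\in M\mid a\leq b\}$ (so every $a\leq b$ becomes isolated). Then $+$ and $\cdot$ are continuous with respect to $\tau^*$, so $M$ with $\tau^*$ is again a topological model of ${\rm PA}^-$.
   Context: ${\rm PA}^-$ is the theory of the non-negative parts of discretely ordered rings (Peano arithmetic without induction); $\leq$ is the order of the model. A topological model of ${\rm PA}^-$ is a topological space with operations $+,\cdot$ continuous in the product topology satisfying ${\rm PA}^-$. -}

module Defs where

open import Level using (Level; 0ℓ; suc; _⊔_)
open import Data.Product using (Σ; Σ-syntax; _×_; ∃)
open import Data.Sum using (_⊎_)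
open import Data.Unit using (⊤)
open import Relation.Nullary using (¬_)
open import Relation.Binary.PropositionalEquality using (_≡_)
open import Relation.Unary using (Pred; _∪_; _∩_; ⋃; _≐_)

-- A model of PA⁻ (Kaye's axiomatisation: non-negative part of a
-- discretely ordered ring), with equality the identity of the carrier.
record PAminus : Set₁ where
  infixl 6 _+_
  infixl 7 _·_
  infix 4 _<_ _≤_
  field
    M   : Set
    _+_ : M → M → M
    _·_ : M → M → M
    𝟘 𝟙 : M
    _<_ : M → M → Set
    +-assoc : ∀ x y z → (x + y) + z ≡ x + (y + z)
    +-comm  : ∀ x y → x + y ≡ y + x
    ·-assoc : ∀ x y z → (x · y) · z ≡ x · (y · z)
    ·-comm  : ∀ x y → x · y ≡ y · x
    distrib : ∀ x y z → x · (y + z) ≡ x · y + x · z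
    +-zero  : ∀ x → x + 𝟘 ≡ x
    ·-zero  : ∀ x → x · 𝟘 ≡ 𝟘
    ·-one   : ∀ x → x · 𝟙 ≡ x
    <-trans : ∀ {x y z} → x < y → y < z → x < z
    <-irrefl : ∀ x → ¬ (x < x)
    <-trich : ∀ x y → x < y ⊎ (x ≡ y ⊎ y < x)
    <-+     : ∀ {x y} z → x < y → x + z < y + z
    <-·     : ∀ {x y z} → 𝟘 < z → x < y → x · z < y · z
    <-sub   : ∀ {x y} → x < y → ∃ λ z → x + z ≡ y
    0<1     : 𝟘 < 𝟙
    discrete : ∀ x → 𝟘 < x → (𝟙 < x ⊎ 𝟙 ≡ x)
    nonneg  : ∀ x → (𝟘 < x ⊎ 𝟘 ≡ x)

  _≤_ : M → M → Set
  x ≤ y = x < y ⊎ x ≡ y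

record IsTopology {ℓ : Level} {X : Set} (Open : Pred X 0ℓ → Set ℓ) : Set (suc 0ℓ ⊔ ℓ) where
  field
    open-resp : ∀ {U V : Pred X 0ℓ} → U ≐ V → Open U → Open V
    open-univ : Open (λ _ → ⊤)
    open-∩    : ∀ {U V : Pred X 0ℓ} → Open U → Open V → Open (U ∩ V)
    open-⋃    : (I : Set) (F : I → Pred X 0ℓ) → (∀ i → Open (F i)) → Open (⋃ I F)

-- W ⊆ X × X (curried) is open in the product topology of (X, Open).
ProdOpen : {ℓ : Level} {X : Set} → (Pred X 0ℓ → Set ℓ) → (X → X → Set) → Set (suc 0ℓ ⊔ ℓ)
ProdOpen {ℓ} {X} Open W =
  ∀ x y → W x y →
    Σ[ U₁ ∈ Pred X 0ℓ ] Σ[ U₂ ∈ Pred X 0ℓ ]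
      (Open U₁ × Open U₂ × U₁ x × U₂ y ×
       (∀ x' y' → U₁ x' → U₂ y' → W x' y'))

ContinuousOp : {ℓ : Level} {X : Set} → (Pred X 0ℓ → Set ℓ) → (X → X → X) → Set (suc 0ℓ ⊔ ℓ)
ContinuousOp {ℓ} {X} Open f = ∀ (V : Pred X 0ℓ) → Open V → ProdOpen Open (λ x y → V (f x y))

record TopModel : Set₁ where
  field
    model : PAminus
  open PAminus model public
  field
    Open  : Pred M 0ℓ → Set
    isTop : IsTopology Open
    +-cont : ContinuousOp Open _+_
    ·-cont : ContinuousOp Open _·_

StarOpen : (T : TopModel) → TopModel.M T → Pred (TopModel.M T) 0ℓ → Set₁
StarOpen T b W =
  Σ[ U ∈ Pred M 0ℓ ] (Open U × Σ[ A ∈ Pred M 0ℓ ] ((∀ a → A a → a ≤ b) × (W ≐ (U ∪ A))))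
  where open TopModel T

module Submission where

-- The topology τ* is an instance of a general construction:
-- given a topology τ on X and a set S ⊆ X, declare W open when W = U ∪ A
-- with U ∈ τ and A ⊆ S.  Equivalently, W is τ*-open iff it has a τ-open
-- "core" U with U ⊆ W ⊆ U ∪ S.  From this characterisation the topology
-- axioms follow at once (cores of intersections/unions are intersections/
-- unions of cores), τ ⊆ τ*, and every point of S is isolated.
--
-- A τ-continuous operation f stays τ*-continuous provided it is locally
-- constant near every pair (x, y) with f x y ∈ S: if f x y lies in the core
-- of W we use τ-continuity, otherwise f x y ∈ S and f is constant on a τ*-
-- neighbourhood of (x, y).  For a model of PA⁻ and S = {a | a ≤ b} this
-- holds for + (x, y ≤ x + y, so {x} × {y} works) and for · ({0} × M or
-- M × {0} if a factor is zero, {x} × {y} otherwise, as x, y ≤ x · y).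

open import Defs
open import Level using (0ℓ)
open import Data.Product using (_×_; _,_; proj₁; proj₂; Σ-syntax)
open import Data.Sum using (inj₁; inj₂)
open import Data.Empty using (⊥)
open import Data.Unit using (tt)
open import Relation.Unary using (Pred; _∪_; _∩_; ⋃; _≐_; _⊆_; ∅; U; ｛_｝)
open import Relation.Binary.PropositionalEquality using (_≡_; refl; sym; trans; subst; subst₂)

module Refinement {X : Set} (Open : Pred X 0ℓ → Set) (isTop : IsTopology Open)
                  (S : Pred X 0ℓ) where
  open IsTopology isTop

  Refined : Pred X 0ℓ → Set₁
  Refined W = Σ[ V ∈ Pred X 0ℓ ] (Open V × Σ[ A ∈ Pred X 0ℓ ] ((∀ a → A a → S a) × (W ≐ (V ∪ A))))

  refined-intro : ∀ {W} (V : Pred X 0ℓ) → Open V → V ⊆ W → W ⊆ V ∪ S → Refined W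
  refined-intro {W} V oV V⊆W W⊆V∪S = V , oV , (W ∩ S) , (λ _ → proj₂) , (to , from)
    where
    to : W ⊆ V ∪ (W ∩ S)
    to w with W⊆V∪S w
    ... | inj₁ v = inj₁ v
    ... | inj₂ s = inj₂ (w , s)
    from : V ∪ (W ∩ S) ⊆ W
    from (inj₁ v)       = V⊆W v
    from (inj₂ (w , _)) = w

  core : ∀ {W} → Refined W → Pred X 0ℓ
  core = proj₁

  core-open : ∀ {W} (r : Refined W) → Open (core r)
  core-open r = proj₁ (proj₂ r)

  core⊆ : ∀ {W} (r : Refined W) → core r ⊆ W
  core⊆ (_ , _ , _ , _ , (_ , from)) v = from (inj₁ v)

  ⊆core∪S : ∀ {W} (r : Refined W) → W ⊆ core r ∪ S
  ⊆core∪S (_ , _ , _ , A⊆S , (to , _)) w with to w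
  ... | inj₁ v = inj₁ v
  ... | inj₂ a = inj₂ (A⊆S _ a)

  open⇒refined : ∀ {V} → Open V → Refined V
  open⇒refined {V} oV = refined-intro V oV (λ v → v) inj₁

  ∅-open : Open ∅
  ∅-open = open-resp ((λ { (() , _) }) , λ ()) (open-⋃ ⊥ (λ ()) (λ ()))

  singleton-refined : ∀ {x} → S x → Refined ｛ x ｝
  singleton-refined Sx = refined-intro ∅ ∅-open (λ ()) (λ { refl → inj₂ Sx })

  refined-resp : ∀ {W W'} → W ≐ W' → Refined W → Refined W'
  refined-resp (W⊆W' , W'⊆W) r =
    refined-intro (core r) (core-open r) (λ v → W⊆W' (core⊆ r v)) (λ w → ⊆core∪S r (W'⊆W w))

  -- The core of an intersection is the intersection of the cores.
  refined-∩ : ∀ {W₁ W₂} → Refined W₁ → Refined W₂ → Refined (W₁ ∩ W₂)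
  refined-∩ r₁ r₂ =
    refined-intro (core r₁ ∩ core r₂) (open-∩ (core-open r₁) (core-open r₂))
      (λ { (v₁ , v₂) → core⊆ r₁ v₁ , core⊆ r₂ v₂ })
      (λ { (w₁ , w₂) → split (⊆core∪S r₁ w₁) (⊆core∪S r₂ w₂) })
    where
    split : ∀ {z} → (core r₁ ∪ S) z → (core r₂ ∪ S) z → ((core r₁ ∩ core r₂) ∪ S) z
    split (inj₁ v₁) (inj₁ v₂) = inj₁ (v₁ , v₂)
    split (inj₁ _)  (inj₂ s)  = inj₂ s
    split (inj₂ s)  _         = inj₂ s

  -- The core of a union is the union of the cores.
  refined-⋃ : (I : Set) (F : I → Pred X 0ℓ) → (∀ i → Refined (F i)) → Refined (⋃ I F)
  refined-⋃ I F r =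
    refined-intro cores (open-⋃ I (λ i → core (r i)) (λ i → core-open (r i)))
      (λ { (i , v) → i , core⊆ (r i) v })
      (λ { (i , w) → split i (⊆core∪S (r i) w) })
    where
    cores : Pred X 0ℓ
    cores = ⋃ I (λ i → core (r i))
    split : ∀ {z} i → (core (r i) ∪ S) z → (cores ∪ S) z
    split i (inj₁ v) = inj₁ (i , v)
    split i (inj₂ s) = inj₂ s

  refined-isTopology : IsTopology Refined
  refined-isTopology = record
    { open-resp = refined-resp
    ; open-univ = open⇒refined open-univ
    ; open-∩    = refined-∩
    ; open-⋃    = refined-⋃
    }

  ConstantNear : (X → X → X) → X → X → Set₁
  ConstantNear f x y =
    Σ[ U₁ ∈ Pred X 0ℓ ] Σ[ U₂ ∈ Pred X 0ℓ ]
      (Refined U₁ × Refined U₂ × U₁ x × U₂ y ×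
       (∀ x' y' → U₁ x' → U₂ y' → f x' y' ≡ f x y))

  isolated-pair : ∀ f {x y} → S x → S y → ConstantNear f x y
  isolated-pair f Sx Sy = ｛ _ ｝ , ｛ _ ｝ , singleton-refined Sx , singleton-refined Sy ,
    refl , refl , λ { _ _ refl refl → refl }

  refined-continuous : ∀ f → ContinuousOp Open f →
    (∀ x y → S (f x y) → ConstantNear f x y) → ContinuousOp Refined f
  refined-continuous f f-cont const W r x y w with ⊆core∪S r w
  ... | inj₁ v with f-cont (core r) (core-open r) x y v
  ...   | U₁ , U₂ , o₁ , o₂ , x∈U₁ , y∈U₂ , maps =
    U₁ , U₂ , open⇒refined o₁ , open⇒refined o₂ , x∈U₁ , y∈U₂ ,
    λ x' y' x'∈U₁ y'∈U₂ → core⊆ r (maps x' y' x'∈U₁ y'∈U₂)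
  refined-continuous f f-cont const W r x y w | inj₂ s with const x y s
  ... | U₁ , U₂ , r₁ , r₂ , x∈U₁ , y∈U₂ , constant =
    U₁ , U₂ , r₁ , r₂ , x∈U₁ , y∈U₂ ,
    λ x' y' x'∈U₁ y'∈U₂ → subst W (sym (constant x' y' x'∈U₁ y'∈U₂)) w

module Order (P : PAminus) where
  open PAminus P

  ≤-trans : ∀ {x y z} → x ≤ y → y ≤ z → x ≤ z
  ≤-trans (inj₁ p)    (inj₁ q)    = inj₁ (<-trans p q)
  ≤-trans (inj₁ p)    (inj₂ refl) = inj₁ p
  ≤-trans (inj₂ refl) q           = q

  0·x≡0 : ∀ x → 𝟘 · x ≡ 𝟘
  0·x≡0 x = trans (·-comm 𝟘 x) (·-zero x)

  x≤x+y : ∀ x y → x ≤ x + y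
  x≤x+y x y with nonneg y
  ... | inj₂ refl = inj₂ (sym (+-zero x))
  ... | inj₁ 0<y  = inj₁ (subst₂ _<_ (trans (+-comm 𝟘 x) (+-zero x)) (+-comm y x) (<-+ x 0<y))

  y≤x+y : ∀ x y → y ≤ x + y
  y≤x+y x y = subst (y ≤_) (+-comm y x) (x≤x+y y x)

  x≤x·y : ∀ x y → 𝟘 < y → x ≤ x · y
  x≤x·y x y 0<y with nonneg x | discrete y 0<y
  ... | inj₂ refl | _         = inj₂ (sym (0·x≡0 y))
  ... | inj₁ _    | inj₂ refl = inj₂ (sym (·-one x))
  ... | inj₁ 0<x  | inj₁ 1<y  =
    inj₁ (subst₂ _<_ (trans (·-comm 𝟙 x) (·-one x)) (·-comm y x) (<-· 0<x 1<y))

  y≤x·y : ∀ x y → 𝟘 < x → y ≤ x · y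
  y≤x·y x y 0<x = subst (y ≤_) (·-comm y x) (x≤x·y y x 0<x)

module StarTopology (T : TopModel) (b : TopModel.M T) where
  open TopModel T
  open Order model
  open Refinement Open isTop (_≤ b) public
  open IsTopology isTop using (open-univ)

  +-constant : ∀ x y → x + y ≤ b → ConstantNear _+_ x y
  +-constant x y s = isolated-pair _+_ (≤-trans (x≤x+y x y) s) (≤-trans (y≤x+y x y) s)

  -- A zero factor makes the product constant on {0} × M (or M × {0}).
  ·-constant : ∀ x y → x · y ≤ b → ConstantNear _·_ x y
  ·-constant x y s with nonneg x | nonneg y
  ... | inj₂ refl | _ =
    ｛ 𝟘 ｝ , U , singleton-refined (≤-trans (inj₂ (sym (0·x≡0 y))) s) ,
    open⇒refined open-univ , refl , tt ,
    λ { _ y' refl _ → trans (0·x≡0 y') (sym (0·x≡0 y)) }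
  ... | inj₁ _ | inj₂ refl =
    U , ｛ 𝟘 ｝ , open⇒refined open-univ , singleton-refined (≤-trans (inj₂ (sym (·-zero x))) s) ,
    tt , refl , λ { x' _ _ refl → trans (·-zero x') (sym (·-zero x)) }
  ... | inj₁ 0<x | inj₁ 0<y =
    isolated-pair _·_ (≤-trans (x≤x·y x y 0<y) s) (≤-trans (y≤x·y x y 0<x) s)

mainTheorem16 : (T : TopModel) (b : TopModel.M T) →
    IsTopology (StarOpen T b) ×
    ContinuousOp (StarOpen T b) (TopModel._+_ T) ×
    ContinuousOp (StarOpen T b) (TopModel._·_ T)
mainTheorem16 T b =
  refined-isTopology ,
  refined-continuous _+_ +-cont +-constant ,
  refined-continuous _·_ ·-cont ·-constant
  where
  open TopModel T
  open StarTopology T b
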